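{- If $G$ is a nonseparable graph each of whose spanning trees has a perfect matching, then $G$ is isomorphic to $K_2$ or to a cycle of even length.
   Context: All graphs are finite and simple. A cut vertex of a graph $G$ is a vertex $v$ such that $G-v$ has more components than $G$. A graph is nonseparable if it is connected and has no cut vertices. -}

module Defs where

open import Data.Nat using (ℕ; zero; suc; _+_; _*_; _≤_; _%_)
open import Data.Fin using (Fin; toℕ)
open import Data.Bool using (Bool; true; false; T)
open import Data.Product using (Σ; ∃; _×_; _,_)
open import Data.Sum using (_⊎_)
open import Relation.Binary.PropositionalEquality using (_≡_; _≢_)
open import Relation.Nullary using (¬_)
open import Function.Bundles using (_↔_; Inverse)

record Graph (n : ℕ) : Set where
  field
    adj   : Fin n → Fin n → Bool
    sym   : ∀ u v → adj u v ≡ adj v u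
    irrefl : ∀ v → adj v v ≡ false
open Graph public

Edge : ∀ {n} → Graph n → Fin n → Fin n → Set
Edge G u v = T (adj G u v)

data Walk {n : ℕ} (R : Fin n → Fin n → Set) : Fin n → Fin n → Set where
  [] : ∀ {u} → Walk R u u
  _∷_ : ∀ {u v w} → R u v → Walk R v w → Walk R u w

Connected : ∀ {n} → Graph n → Set
Connected G = ∀ u v → Walk (Edge G) u v

EdgeMinus : ∀ {n} → Graph n → Fin n → Fin n → Fin n → Set
EdgeMinus G x u v = Edge G u v × u ≢ x × v ≢ x

-- x is a cut vertex: G - x has more components than G, i.e. two vertices
-- of G - x lie in the same component of G but in different components of G - x.
CutVertex : ∀ {n} → Graph n → Fin n → Set
CutVertex G x = Σ _ λ u → Σ _ λ w → u ≢ x × w ≢ x ×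
  Walk (Edge G) u w × ¬ Walk (EdgeMinus G x) u w

Nonseparable : ∀ {n} → Graph n → Set
Nonseparable G = Connected G × (∀ x → ¬ CutVertex G x)

SpanningSub : ∀ {n} → Graph n → Graph n → Set
SpanningSub H G = ∀ u v → Edge H u v → Edge G u v

record Cycle {n : ℕ} (G : Graph n) : Set where
  field
    k     : ℕ
    len   : 3 ≤ suc k
    c     : Fin (suc k) → Fin n
    inj   : ∀ i j → c i ≡ c j → i ≡ j
    step  : ∀ (i : Fin (suc k)) (j : Fin (suc k)) →
            toℕ j ≡ (toℕ i + 1) % suc k → Edge G (c i) (c j)

Acyclic : ∀ {n} → Graph n → Set
Acyclic G = ¬ Cycle G

Tree : ∀ {n} → Graph n → Set
Tree G = Connected G × Acyclic G

SpanningTree : ∀ {n} → Graph n → Graph n → Set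
SpanningTree T G = SpanningSub T G × Tree T

record PerfectMatching {n : ℕ} (H : Graph n) : Set₁ where
  field
    M      : Fin n → Fin n → Set
    M-sym  : ∀ u v → M u v → M v u
    M-edge : ∀ u v → M u v → Edge H u v
    unique : ∀ v → Σ (Fin n) λ w → M v w × (∀ w' → M v w' → w' ≡ w)

-- Graph isomorphism
-- (stated against the target's adjacency function, so that model graphs
-- such as the cycle C_k can be given just by their adjacency)
Iso : ∀ {n m} → Graph n → (Fin m → Fin m → Bool) → Set
Iso {n} {m} G adjH = Σ (Fin n ↔ Fin m) λ f →
  ∀ u v → adj G u v ≡ adjH (Inverse.to f u) (Inverse.to f v)

-- Complete graph K_2 is defined below; the cycle graph C_(suc k):
-- i ~ j iff j ≡ i+1 mod (suc k) or i ≡ j+1 mod (suc k)  (a simple cycle for suc k ≥ 3)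
open import Data.Nat using (_≡ᵇ_)
open import Data.Bool using (_∨_; not)
import Data.Fin.Properties as FP
open import Relation.Nullary.Decidable using (⌊_⌋)

K₂ : Graph 2
K₂ = record { adj = λ u v → not ⌊ u FP.≟ v ⌋ ; sym = s ; irrefl = i }
  where
  s : ∀ u v → not ⌊ u FP.≟ v ⌋ ≡ not ⌊ v FP.≟ u ⌋
  s Fin.zero Fin.zero = _≡_.refl
  s Fin.zero (Fin.suc Fin.zero) = _≡_.refl
  s (Fin.suc Fin.zero) Fin.zero = _≡_.refl
  s (Fin.suc Fin.zero) (Fin.suc Fin.zero) = _≡_.refl
  i : ∀ v → not ⌊ v FP.≟ v ⌋ ≡ false
  i Fin.zero = _≡_.refl
  i (Fin.suc Fin.zero) = _≡_.refl

cycAdj : (k : ℕ) → Fin (suc k) → Fin (suc k) → Bool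
cycAdj k i j = (toℕ j ≡ᵇ (toℕ i + 1) % suc k) ∨ (toℕ i ≡ᵇ (toℕ j + 1) % suc k)

module Submission where

-- Perfect matchings enter through parity: a matching is
-- a fixed-point-free involution p along edges, so a vertex set that edges leave
-- only towards a vertex e, with p e outside the set, has even size.  Every
-- connected spanning subgraph of G carries such an involution (a BFS tree of it
-- is a spanning tree of G); for G itself this makes the order of G even.
-- The core is that no vertex v has three neighbours a, b, c: BFS from a in the
-- connected graph G - v gives a tree; deleting some parent edges and joining v
-- to a, b, c yields connected spanning subgraphs in which two disjoint odd
-- vertex sets are left only through v, which parity forbids.  A nonseparable
-- graph on at least three vertices of maximum degree 2 is a cycle, numbered by
-- depth in the BFS tree of G - v.

open import Data.Nat using (ℕ; zero; suc; pred; _+_; _*_; _∸_; _≤_; _<_; z≤n; s≤s; ≤′-refl; ≤′-step;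
  _%_; _≡ᵇ_)
open import Data.Nat.Properties hiding (_≟_)
open import Data.Fin using (Fin; zero; suc; toℕ; fromℕ; fromℕ<; inject₁; punchOut)
open import Data.Fin.Properties using (_≟_; any?; punchOut-injective; injective⇒≤; toℕ-injective;
  toℕ-fromℕ; toℕ-fromℕ<; toℕ-inject₁; toℕ<n)
open import Data.Nat.DivMod using (m≤n⇒m%n≡m; n%n≡0; m%n<n)
open import Function.Bundles using (_↔_; Inverse; mk↔ₛ′; Equivalence)
open import Relation.Binary.Definitions using (tri<; tri≈; tri>)
open import Data.Bool using (Bool; true; false; T; _∧_; _∨_; not; if_then_else_)
open import Data.Bool.Properties using (∨-comm; ∧-identityʳ; T-∨; T-∧; T-≡)
open import Data.List using (List; []; _∷_)
open import Data.List.Membership.Propositional using (_∈_)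
open import Data.List.Relation.Unary.Any using (here; there)
open import Data.Maybe using (Maybe; just; nothing; maybe′) renaming (map to mapMaybe)
open import Data.Product using (Σ; _×_; _,_; proj₁; proj₂)
open import Data.Sum using (_⊎_; inj₁; inj₂)
open import Data.Empty using (⊥; ⊥-elim)
open import Data.Unit using (tt)
open import Function using (_∘_; id)
open import Relation.Nullary using (¬_; Dec; yes; no)
open import Relation.Nullary.Decidable using (T?; _×-dec_; ¬?)
open import Relation.Binary.PropositionalEquality

open import Defs using (Graph; adj; Edge; Walk; []; _∷_; Connected; EdgeMinus; Nonseparable;
  Cycle; Acyclic; Tree; SpanningSub; SpanningTree; PerfectMatching; Iso; K₂; cycAdj)

-- The Booleans are implicit but often have to be supplied, since unification
-- cannot recover them from a type such as T (a ∨ b).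
∨-introˡ : ∀ {a b} → T a → T (a ∨ b)
∨-introˡ {a} {b} t = Equivalence.from (T-∨ {a} {b}) (inj₁ t)

∨-introʳ : ∀ {a b} → T b → T (a ∨ b)
∨-introʳ {a} {b} t = Equivalence.from (T-∨ {a} {b}) (inj₂ t)

∨-elim : ∀ {a b} → T (a ∨ b) → T a ⊎ T b
∨-elim {a} {b} = Equivalence.to (T-∨ {a} {b})

∧-intro : ∀ {a b} → T a → T b → T (a ∧ b)
∧-intro {a} {b} s t = Equivalence.from (T-∧ {a} {b}) (s , t)

∧-fst : ∀ {a b} → T (a ∧ b) → T a
∧-fst {a} {b} t = proj₁ (Equivalence.to (T-∧ {a} {b}) t)

∧-snd : ∀ {a b} → T (a ∧ b) → T b
∧-snd {a} {b} t = proj₂ (Equivalence.to (T-∧ {a} {b}) t)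

not-intro : ∀ {a} → ¬ T a → T (not a)
not-intro {true} f = f tt
not-intro {false} f = tt

not-elim : ∀ {a} → T (not a) → ¬ T a
not-elim {true} () _

T⇒true : ∀ {b} → T b → b ≡ true
T⇒true = Equivalence.to T-≡

¬T⇒false : ∀ {b} → ¬ T b → b ≡ false
¬T⇒false {true} f = ⊥-elim (f tt)
¬T⇒false {false} f = refl

T-ext : ∀ {a b} → (T a → T b) → (T b → T a) → a ≡ b
T-ext {true} {true} f g = refl
T-ext {true} {false} f g = ⊥-elim (f tt)
T-ext {false} {true} f g = ⊥-elim (g tt)
T-ext {false} {false} f g = refl

_==_ : ∀ {n} → Fin n → Fin n → Bool
zero == zero = true
zero == suc _ = false
suc _ == zero = false
suc x == suc y = x == y

==⇒≡ : ∀ {n} {x y : Fin n} → T (x == y) → x ≡ y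
==⇒≡ {x = zero} {zero} _ = refl
==⇒≡ {x = suc x} {suc y} t = cong suc (==⇒≡ t)

==-refl : ∀ {n} (x : Fin n) → T (x == x)
==-refl zero = tt
==-refl (suc x) = ==-refl x

≡⇒== : ∀ {n} {x y : Fin n} → x ≡ y → T (x == y)
≡⇒== {x = x} refl = ==-refl x

≢⇒not== : ∀ {n} {x y : Fin n} → x ≢ y → T (not (x == y))
≢⇒not== ne = not-intro (ne ∘ ==⇒≡)

not==⇒≢ : ∀ {n} {x y : Fin n} → T (not (x == y)) → x ≢ y
not==⇒≢ t = not-elim t ∘ ≡⇒==

any : ∀ {n} → (Fin n → Bool) → Bool
any {zero} f = false
any {suc n} f = f zero ∨ any (f ∘ suc)

any-intro : ∀ {n} (f : Fin n → Bool) u → T (f u) → T (any f)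
any-intro f zero t = ∨-introˡ t
any-intro f (suc u) t = ∨-introʳ {f zero} (any-intro (f ∘ suc) u t)

first : ∀ {n} → (Fin n → Bool) → Maybe (Fin n)
first {zero} f = nothing
first {suc n} f = if f zero then just zero else mapMaybe suc (first (f ∘ suc))

first-found : ∀ {n} (f : Fin n → Bool) → T (any f) → Σ (Fin n) λ u → first f ≡ just u × T (f u)
first-found {suc n} f t with f zero in eq
... | true = zero , refl , subst T (sym eq) tt
... | false with first-found (f ∘ suc) t
... | u , e , tu rewrite e = suc u , refl , tu

any-elim : ∀ {n} (f : Fin n → Bool) → T (any f) → Σ (Fin n) λ u → T (f u)
any-elim f t with first-found f t
... | u , _ , tu = u , tu

count : ∀ {N} → (Fin N → Bool) → ℕ
count {zero} P = 0
count {suc N} P = (if P zero then 1 else 0) + count (P ∘ suc)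

count-all : ∀ {N} → count {N} (λ _ → true) ≡ N
count-all {zero} = refl
count-all {suc N} = cong suc (count-all {N})

count-≤ : ∀ {N} (P : Fin N → Bool) → count P ≤ N
count-≤ {zero} P = z≤n
count-≤ {suc N} P with P zero
... | true = s≤s (count-≤ (P ∘ suc))
... | false = m≤n⇒m≤1+n (count-≤ (P ∘ suc))

count-mono : ∀ {N} (P Q : Fin N → Bool) → (∀ z → T (P z) → T (Q z)) → count P ≤ count Q
count-mono {zero} P Q f = z≤n
count-mono {suc N} P Q f with P zero | Q zero | f zero
... | true | true | _ = s≤s (count-mono (P ∘ suc) (Q ∘ suc) (f ∘ suc))
... | true | false | g = ⊥-elim (g tt)
... | false | true | _ = m≤n⇒m≤1+n (count-mono (P ∘ suc) (Q ∘ suc) (f ∘ suc))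
... | false | false | _ = count-mono (P ∘ suc) (Q ∘ suc) (f ∘ suc)

count-cong : ∀ {N} (P Q : Fin N → Bool) → (∀ z → P z ≡ Q z) → count P ≡ count Q
count-cong {zero} P Q e = refl
count-cong {suc N} P Q e rewrite e zero = cong (_ +_) (count-cong (P ∘ suc) (Q ∘ suc) (e ∘ suc))

count-strict : ∀ {N} (P Q : Fin N → Bool) → (∀ z → T (P z) → T (Q z)) →
  (y : Fin N) → T (Q y) → ¬ T (P y) → count P < count Q
count-strict {suc N} P Q f zero qy npy with P zero | Q zero
... | true | _ = ⊥-elim (npy tt)
... | false | true = s≤s (count-mono (P ∘ suc) (Q ∘ suc) (f ∘ suc))
... | false | false = ⊥-elim qy
count-strict {suc N} P Q f (suc y) qy npy with P zero | Q zero | f zero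
... | true | true | _ = s≤s (count-strict (P ∘ suc) (Q ∘ suc) (f ∘ suc) y qy npy)
... | true | false | g = ⊥-elim (g tt)
... | false | true | _ = m≤n⇒m≤1+n (count-strict (P ∘ suc) (Q ∘ suc) (f ∘ suc) y qy npy)
... | false | false | _ = count-strict (P ∘ suc) (Q ∘ suc) (f ∘ suc) y qy npy

count-pos : ∀ {N} (P : Fin N → Bool) y → T (P y) → 0 < count P
count-pos P y t = ≤-trans (s≤s z≤n) (count-strict (λ _ → false) P (λ _ ()) y t (λ ()))

empty-or-inhabited : ∀ {N} (P : Fin N → Bool) → count P ≡ 0 ⊎ Σ (Fin N) λ y → T (P y)
empty-or-inhabited {zero} P = inj₁ refl
empty-or-inhabited {suc N} P with P zero in eq
... | true = inj₂ (zero , subst T (sym eq) tt)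
... | false with empty-or-inhabited (P ∘ suc)
... | inj₁ e = inj₁ e
... | inj₂ (y , t) = inj₂ (suc y , t)

remove : ∀ {N} → (Fin N → Bool) → Fin N → Fin N → Bool
remove P y z = P z ∧ not (z == y)

remove-intro : ∀ {N} (P : Fin N → Bool) {y z} → T (P z) → z ≢ y → T (remove P y z)
remove-intro P pz zy = ∧-intro pz (≢⇒not== zy)

remove-elim : ∀ {N} (P : Fin N → Bool) {y z} → T (remove P y z) → T (P z) × z ≢ y
remove-elim P {y} {z} t = ∧-fst {P z} t , not==⇒≢ (∧-snd {P z} t)

count-remove : ∀ {N} (P : Fin N → Bool) (y : Fin N) → T (P y) → count P ≡ suc (count (remove P y))
count-remove {suc N} P zero t with P zero
... | true = cong suc (count-cong (P ∘ suc) _ (λ z → sym (∧-identityʳ (P (suc z)))))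
count-remove {suc N} P (suc y) t with P zero
... | true = cong suc (count-remove (P ∘ suc) y t)
... | false = count-remove (P ∘ suc) y t

⟨_⟩ : ∀ {N} → List (Fin N) → Fin N → Bool
⟨ [] ⟩ z = false
⟨ x ∷ xs ⟩ z = (z == x) ∨ ⟨ xs ⟩ z

⟨⟩-intro : ∀ {N} (xs : List (Fin N)) {z} → z ∈ xs → T (⟨ xs ⟩ z)
⟨⟩-intro (x ∷ _) (here refl) = ∨-introˡ {x == x} (==-refl x)
⟨⟩-intro (x ∷ xs) {z} (there m) = ∨-introʳ {z == x} (⟨⟩-intro xs m)

⟨⟩-elim : ∀ {N} (xs : List (Fin N)) z → T (⟨ xs ⟩ z) → z ∈ xs
⟨⟩-elim (x ∷ xs) z t with ∨-elim {z == x} t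
... | inj₁ e = here (==⇒≡ e)
... | inj₂ m = there (⟨⟩-elim xs z m)

count-split : ∀ {N} (P R : Fin N → Bool) →
  count (λ z → P z ∧ R z) + count (λ z → not (P z) ∧ R z) ≡ count R
count-split {zero} P R = refl
count-split {suc N} P R with P zero | R zero
... | true | true = cong suc (count-split (P ∘ suc) (R ∘ suc))
... | true | false = count-split (P ∘ suc) (R ∘ suc)
... | false | true = trans (+-suc _ _) (cong suc (count-split (P ∘ suc) (R ∘ suc)))
... | false | false = count-split (P ∘ suc) (R ∘ suc)

data Even : ℕ → Set where
  even-0 : Even 0
  even-2+ : ∀ {n} → Even n → Even (suc (suc n))

even⇒¬odd : ∀ {n} → Even n → ¬ Even (suc n)
even⇒¬odd even-0 ()
even⇒¬odd (even-2+ e) (even-2+ e') = even⇒¬odd e e'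

even-+ : ∀ {m n} → Even m → Even n → Even (m + n)
even-+ even-0 e = e
even-+ (even-2+ e) e' = even-2+ (even-+ e e')

even⇒double : ∀ {n} → Even n → Σ ℕ λ m → n ≡ 2 * m
even⇒double even-0 = 0 , refl
even⇒double (even-2+ {n} e) with even⇒double e
... | m , refl = suc m , cong suc (sym (+-suc m (m + 0)))

-- A set closed under a fixed-point-free involution p is a disjoint union of
-- orbits {y, p y}, hence has even size.  This is how perfect matchings are used.
module InvolutionParity {N : ℕ} (p : Fin N → Fin N)
    (p-invol : ∀ y → p (p y) ≡ y) (p-nofix : ∀ y → p y ≢ y) where

  Closed : (Fin N → Bool) → Set
  Closed P = ∀ y → T (P y) → T (P (p y))

  remove-orbit-closed : ∀ P y → Closed P → Closed (remove (remove P y) (p y))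
  remove-orbit-closed P y cl z t with remove-elim (remove P y) t
  ... | t' , z≢py with remove-elim P t'
  ... | pz , z≢y = remove-intro (remove P y) (remove-intro P (cl z pz) pz≢y) pz≢py
    where
    pz≢y : p z ≢ y
    pz≢y e = z≢py (trans (sym (p-invol z)) (cong p e))
    pz≢py : p z ≢ p y
    pz≢py e = z≢y (trans (sym (p-invol z)) (trans (cong p e) (p-invol y)))

  remove-orbit-count : ∀ P y → Closed P → T (P y) →
    count P ≡ suc (suc (count (remove (remove P y) (p y))))
  remove-orbit-count P y cl py =
    trans (count-remove P y py)
      (cong suc (count-remove (remove P y) (p y) (remove-intro P (cl y py) (p-nofix y))))

  even-if-bounded : ∀ k P → count P ≤ k → Closed P → Even (count P)
  even-if-bounded k P le cl with empty-or-inhabited P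
  ... | inj₁ empty = subst Even (sym empty) even-0
  even-if-bounded zero P le cl | inj₂ (y , py) = ⊥-elim (<⇒≱ (count-pos P y py) le)
  even-if-bounded (suc k) P le cl | inj₂ (y , py) =
    subst Even (sym size) (even-2+ (even-if-bounded k P' le' (remove-orbit-closed P y cl)))
    where
    P' : Fin N → Bool
    P' = remove (remove P y) (p y)
    size : count P ≡ suc (suc (count P'))
    size = remove-orbit-count P y cl py
    le' : count P' ≤ k
    le' = ≤-pred (≤-trans (n≤1+n _) (subst (_≤ suc k) size le))

  closed-even : ∀ P → Closed P → Even (count P)
  closed-even P = even-if-bounded (count P) P ≤-refl

_++ʷ_ : ∀ {n} {R : Fin n → Fin n → Set} {x y z} → Walk R x y → Walk R y z → Walk R x z
[] ++ʷ q = q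
(e ∷ p) ++ʷ q = e ∷ (p ++ʷ q)

reverseʷ : ∀ {n} {R : Fin n → Fin n → Set} → (∀ x y → R x y → R y x) →
  ∀ {x y} → Walk R x y → Walk R y x
reverseʷ s [] = []
reverseʷ s (e ∷ p) = reverseʷ s p ++ʷ (s _ _ e ∷ [])

mapʷ : ∀ {n} {R S : Fin n → Fin n → Set} → (∀ x y → R x y → S x y) →
  ∀ {x y} → Walk R x y → Walk S x y
mapʷ f [] = []
mapʷ f (e ∷ p) = f _ _ e ∷ mapʷ f p

first-step : ∀ {n} {R : Fin n → Fin n → Set} {x y} → Walk R x y → x ≢ y → Σ (Fin n) λ z → R x z
first-step [] ne = ⊥-elim (ne refl)
first-step (_∷_ {v = z} e _) ne = z , e

edge-sym : ∀ {n} (G : Graph n) x y → Edge G x y → Edge G y x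
edge-sym G x y e = subst T (Graph.sym G x y) e

edge-≢ : ∀ {n} (G : Graph n) {x y} → Edge G x y → y ≢ x
edge-≢ G {x} e refl = subst T (Graph.irrefl G x) e

connected-via : ∀ {n} (G : Graph n) (h : Fin n) → (∀ x → Walk (Edge G) x h) → Connected G
connected-via G h f x y = f x ++ʷ reverseʷ (edge-sym G) (f y)

module BFS {N : ℕ} (E : Fin N → Fin N → Bool) (r : Fin N) where
  abstract
    within : ℕ → Fin N → Bool
    within zero w = w == r
    within (suc k) w = within k w ∨ any (λ u → within k u ∧ E u w)

    within-step : ∀ k u w → T (within k u) → T (E u w) → T (within (suc k) w)
    within-step k u w ru e = ∨-introʳ {within k w} (any-intro (λ u → within k u ∧ E u w) u (∧-intro ru e))

    within-mono : ∀ {i k w} → i ≤ k → T (within i w) → T (within k w)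
    within-mono {i} {k} {w} le t with ≤⇒≤′ le
    ... | ≤′-refl = t
    ... | ≤′-step le' = ∨-introˡ (within-mono (≤′⇒≤ le') t)

    Stable : ℕ → Set
    Stable k = ∀ w → T (within (suc k) w) → T (within k w)

    stable-suc : ∀ k → Stable k → Stable (suc k)
    stable-suc k st w t with ∨-elim {within (suc k) w} t
    ... | inj₁ x = x
    ... | inj₂ y with any-elim _ y
    ... | u , tu = within-step k u w (st u (∧-fst {within (suc k) u} tu)) (∧-snd {within (suc k) u} tu)

    stable-+ : ∀ k j → Stable k → Stable (j + k)
    stable-+ k zero st = st
    stable-+ k (suc j) st = stable-suc (j + k) (stable-+ k j st)

    stable-up : ∀ k j → Stable k → ∀ w → T (within (j + k) w) → T (within k w)
    stable-up k zero st w t = t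
    stable-up k (suc j) st w t = stable-up k j st w (stable-+ k j st w t)

    stable? : ∀ k → Stable k ⊎ Σ (Fin N) λ w → T (within (suc k) w) × ¬ T (within k w)
    stable? k with T? (any (λ w → within (suc k) w ∧ not (within k w)))
    ... | yes t with any-elim _ t
    ... | w , tw = inj₂ (w , ∧-fst {within (suc k) w} tw , not-elim (∧-snd {within (suc k) w} tw))
    stable? k | no nt = inj₁ λ w t → old w t (T? (within k w))
      where
      old : ∀ w → T (within (suc k) w) → Dec (T (within k w)) → T (within k w)
      old w t (yes x) = x
      old w t (no y) = ⊥-elim (nt (any-intro _ w (∧-intro t (not-intro y))))

    growth : ∀ k → (Σ ℕ λ j → j ≤ k × Stable j) ⊎ suc k ≤ count (within k)
    growth zero = inj₂ (count-pos (within zero) r (==-refl r))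
    growth (suc k) with growth k
    ... | inj₁ (j , le , st) = inj₁ (j , m≤n⇒m≤1+n le , st)
    ... | inj₂ lt with stable? k
    ... | inj₁ st = inj₁ (k , n≤1+n k , st)
    ... | inj₂ (w , t , nt) =
      inj₂ (≤-trans (s≤s lt) (count-strict (within k) (within (suc k)) (λ z → ∨-introˡ) w t nt))

    stabilises : Σ ℕ λ j → j ≤ N × Stable j
    stabilises with growth N
    ... | inj₁ x = x
    ... | inj₂ lt = ⊥-elim (<-irrefl refl (≤-trans lt (count-≤ (within N))))

    Reached : Fin N → Set
    Reached w = T (within N w)

    reached? : ∀ w → Dec (Reached w)
    reached? w = T? (within N w)

    reached-step : ∀ u w → Reached u → T (E u w) → Reached w
    reached-step u w ru e with stabilises
    ... | j , le , st =
      within-mono le (st w (within-step j u w (stable-up j (N ∸ j) st u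
        (subst (λ m → T (within m u)) (sym (m∸n+n≡m le)) ru)) e))

    reached-walk : ∀ {u w} → Walk (λ x y → T (E x y)) u w → Reached u → Reached w
    reached-walk [] ru = ru
    reached-walk (_∷_ {v = v} e wk) ru = reached-walk wk (reached-step _ v ru e)

    root-reached : Reached r
    root-reached = within-mono {0} {N} {r} z≤n (==-refl r)

    unreached : (v : Fin N) → v ≢ r → (∀ u → ¬ T (E u v)) → ¬ Reached v
    unreached v v≢r no-in = go N
      where
      go : ∀ k → ¬ T (within k v)
      go zero t = v≢r (==⇒≡ t)
      go (suc k) t with ∨-elim {within k v} t
      ... | inj₁ x = go k x
      ... | inj₂ y with any-elim _ y
      ... | u , tu = no-in u (∧-snd {within k u} tu)

    -- rank w: the least k with w reachable within k steps (0 if unreached)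
    least : ℕ → Fin N → ℕ
    least zero w = 0
    least (suc k) w = if within k w then least k w else suc k

    least-ok : ∀ k w → T (within k w) → T (within (least k w) w)
    least-ok zero w t = t
    least-ok (suc k) w t with within k w in eq
    ... | true = least-ok k w (subst T (sym eq) tt)
    ... | false = ∨-introʳ {within k w} t

    least-min : ∀ k w i → i < least k w → ¬ T (within i w)
    least-min (suc k) w i lt with within k w in eq
    ... | true = least-min k w i lt
    ... | false = λ ti → subst T eq (within-mono (≤-pred lt) ti)

    least-≤ : ∀ k w → least k w ≤ k
    least-≤ zero w = z≤n
    least-≤ (suc k) w with within k w
    ... | true = m≤n⇒m≤1+n (least-≤ k w)
    ... | false = ≤-refl

    rank : Fin N → ℕ
    rank w = least N w

    rank-ok : ∀ w → Reached w → T (within (rank w) w)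
    rank-ok w t = least-ok N w t

    rank-min : ∀ w i → T (within i w) → rank w ≤ i
    rank-min w i t with ≤-<-connex (rank w) i
    ... | inj₁ le = le
    ... | inj₂ lt = ⊥-elim (least-min N w i lt t)

    rank-root : rank r ≡ 0
    rank-root = n≤0⇒n≡0 (rank-min r 0 (==-refl r))

    rank-0 : ∀ w → Reached w → rank w ≡ 0 → w ≡ r
    rank-0 w t e = ==⇒≡ (subst (λ m → T (within m w)) e (rank-ok w t))

    rank-adj : ∀ x y → Reached x → T (E x y) → rank y ≤ suc (rank x)
    rank-adj x y t e = rank-min y (suc (rank x)) (within-step (rank x) x y (rank-ok x t) e)

    parent-at : ℕ → Fin N → Fin N
    parent-at zero w = r
    parent-at (suc j) w = maybe′ id r (first (λ u → within j u ∧ E u w))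

    par : Fin N → Fin N
    par w = parent-at (rank w) w

    par-spec : ∀ w → Reached w → w ≢ r →
      T (E (par w) w) × rank (par w) < rank w × Reached (par w)
    par-spec w t ne with rank w in eq | rank-ok w t | least-min N w | least-≤ N w
    ... | zero | t0 | _ | _ = ⊥-elim (ne (==⇒≡ t0))
    ... | suc j | t1 | mn | le with ∨-elim {within j w} t1
    ... | inj₁ x = ⊥-elim (mn j ≤-refl x)
    ... | inj₂ y with first-found (λ u → within j u ∧ E u w) y
    ... | u , e , tu rewrite e =
      ∧-snd {within j u} tu , s≤s (rank-min u j (∧-fst {within j u} tu)) ,
      within-mono (≤-trans (n≤1+n j) le) (∧-fst {within j u} tu)

    par-ok : ∀ w → Reached w → w ≢ r → T (E (par w) w) × rank (par w) < rank w
    par-ok w t ne = let (e , lt , _) = par-spec w t ne in e , lt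

    par-reached : ∀ w → Reached w → w ≢ r → Reached (par w)
    par-reached w t ne = proj₂ (proj₂ (par-spec w t ne))

succ-mod : ∀ {m k} → m ≤ k →
  (m < k × (m + 1) % suc k ≡ suc m) ⊎ (m ≡ k × (m + 1) % suc k ≡ 0)
succ-mod {m} {k} le with m≤n⇒m<n∨m≡n le
... | inj₁ lt = inj₁ (lt , trans (m≤n⇒m%n≡m (subst (_≤ k) (+-comm 1 m) lt)) (+-comm m 1))
... | inj₂ refl = inj₂ (refl , trans (cong (_% suc m) (+-comm m 1)) (n%n≡0 (suc m)))

succ-mod-< : ∀ {m k} → m < k → (m + 1) % suc k ≡ suc m
succ-mod-< {m} {k} lt with succ-mod {m} {k} (<⇒≤ lt)
... | inj₁ (_ , e) = e
... | inj₂ (e , _) = ⊥-elim (<-irrefl e lt)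

succ-mod-top : ∀ k → (k + 1) % suc k ≡ 0
succ-mod-top k with succ-mod {k} {k} ≤-refl
... | inj₁ (lt , _) = ⊥-elim (<-irrefl refl lt)
... | inj₂ (_ , e) = e

predecessor : ∀ {k} (i : Fin (suc k)) → Σ (Fin (suc k)) λ h → toℕ i ≡ (toℕ h + 1) % suc k
predecessor {k} zero = fromℕ k , sym (trans (cong (λ m → (m + 1) % suc k) (toℕ-fromℕ k)) (succ-mod-top k))
predecessor {suc k} (suc i) = inject₁ i ,
  sym (trans (cong (λ m → (m + 1) % suc (suc k)) (toℕ-inject₁ i)) (succ-mod-< (toℕ<n i)))

successor : ∀ {k} (i : Fin (suc k)) → Σ (Fin (suc k)) λ j → toℕ j ≡ (toℕ i + 1) % suc k
successor {k} i = fromℕ< (m%n<n (toℕ i + 1) (suc k)) , toℕ-fromℕ< _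

two-steps-≢ : ∀ {i k} → 2 ≤ k → i ≤ k → i ≢ ((i + 1) % suc k + 1) % suc k
two-steps-≢ {i} {k} k≥2 i≤k e with succ-mod {i} {k} i≤k
... | inj₂ (refl , e₁) rewrite e₁ | succ-mod-< {0} {i} (≤-trans (s≤s z≤n) k≥2) =
  <-irrefl refl (≤-trans k≥2 (≤-reflexive e))
... | inj₁ (i<k , e₁) rewrite e₁ with succ-mod {suc i} {k} i<k
... | inj₁ (_ , e₂) = <-irrefl refl (≤-trans (n≤1+n _) (≤-reflexive (sym (trans e e₂))))
... | inj₂ (refl , e₂) = <-irrefl refl (≤-trans k≥2 (s≤s (≤-reflexive (trans e e₂))))

argmax : ∀ {n} (g : Fin (suc n) → ℕ) → Σ (Fin (suc n)) λ i → ∀ j → g j ≤ g i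
argmax {zero} g = zero , λ { zero → ≤-refl }
argmax {suc n} g with argmax (g ∘ suc)
... | i , pf with ≤-total (g (suc i)) (g zero)
... | inj₁ le = zero , λ { zero → ≤-refl ; (suc j) → ≤-trans (pf j) le }
... | inj₂ le = suc i , λ { zero → le ; (suc j) → pf j }

module ParentTree {N : ℕ} (r : Fin N) (par : Fin N → Fin N) (rank : Fin N → ℕ)
    (rank-par : ∀ w → w ≢ r → rank (par w) < rank w) where

  child-of : Fin N → Fin N → Bool
  child-of x y = not (x == r) ∧ (par x == y)

  child-of-elim : ∀ x y → T (child-of x y) → x ≢ r × par x ≡ y
  child-of-elim x y t = not==⇒≢ (∧-fst {not (x == r)} t) , ==⇒≡ (∧-snd {not (x == r)} t)

  child-of-irrefl : ∀ x → child-of x x ≡ false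
  child-of-irrefl x = ¬T⇒false λ t →
    let (ne , e) = child-of-elim x x t in <-irrefl (cong rank e) (rank-par x ne)

  tree-graph : Graph N
  tree-graph = record
    { adj = λ x y → child-of x y ∨ child-of y x
    ; sym = λ x y → ∨-comm (child-of x y) (child-of y x)
    ; irrefl = λ x → cong (λ b → b ∨ b) (child-of-irrefl x) }

  tree-edge-elim : ∀ x y → Edge tree-graph x y → (x ≢ r × par x ≡ y) ⊎ (y ≢ r × par y ≡ x)
  tree-edge-elim x y t with ∨-elim {child-of x y} t
  ... | inj₁ a = inj₁ (child-of-elim x y a)
  ... | inj₂ b = inj₂ (child-of-elim y x b)

  tree-edge : ∀ x → x ≢ r → Edge tree-graph x (par x)
  tree-edge x ne = ∨-introˡ (∧-intro (≢⇒not== ne) (==-refl (par x)))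

  to-root : ∀ m x → rank x ≤ m → Walk (Edge tree-graph) x r
  to-root m x le with x ≟ r
  ... | yes refl = []
  to-root zero x le | no ne = ⊥-elim (n≮0 (≤-trans (rank-par x ne) le))
  to-root (suc m) x le | no ne = tree-edge x ne ∷ to-root m (par x) (≤-pred (≤-trans (rank-par x ne) le))

  connected : Connected tree-graph
  connected = connected-via tree-graph r (λ x → to-root (rank x) x ≤-refl)

  -- On a cycle, the vertex of maximal rank would have both cycle neighbours
  -- as its parent, forcing them to coincide.
  acyclic : Acyclic tree-graph
  acyclic cyc with argmax (rank ∘ Cycle.c cyc)
  ... | i , maximal with successor i | predecessor i
  ... | j , ej | h , eh = two-steps-≢ (≤-pred (Cycle.len cyc)) (≤-pred (toℕ<n i)) i≡i+2
    where
    open Cycle cyc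
    parent-of-max : ∀ y → Edge tree-graph (c i) (c y) → par (c i) ≡ c y
    parent-of-max y e with tree-edge-elim (c i) (c y) e
    ... | inj₁ (_ , e') = e'
    ... | inj₂ (ne , e') =
      ⊥-elim (<-irrefl refl (≤-trans (subst (λ z → rank z < rank (c y)) e' (rank-par (c y) ne)) (maximal y)))
    j≡h : j ≡ h
    j≡h = inj j h (trans (sym (parent-of-max j (step i j ej)))
                         (parent-of-max h (edge-sym tree-graph (c h) (c i) (step h i eh))))
    i≡i+2 : toℕ i ≡ ((toℕ i + 1) % suc k + 1) % suc k
    i≡i+2 = trans eh (cong (λ m → (m + 1) % suc k) (trans (cong toℕ (sym j≡h)) ej))

  tree : Tree tree-graph
  tree = connected , acyclic

spanning-tree : ∀ {n} (H : Graph (suc n)) → Connected H → Σ (Graph (suc n)) λ Tr → SpanningTree Tr H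
spanning-tree H conn = tree-graph , sub , tree
  where
  open BFS (adj H) zero
  reached : ∀ w → Reached w
  reached w = reached-walk (conn zero w) root-reached
  open ParentTree zero par rank (λ w ne → proj₂ (par-ok w (reached w) ne))
  sub : SpanningSub tree-graph H
  sub x y e with tree-edge-elim x y e
  ... | inj₁ (ne , refl) = edge-sym H (par x) x (proj₁ (par-ok x (reached x) ne))
  ... | inj₂ (ne , refl) = proj₁ (par-ok y (reached y) ne)

record MatchingInvolution {N : ℕ} (H : Graph N) : Set where
  field
    p : Fin N → Fin N
    p-invol : ∀ y → p (p y) ≡ y
    p-nofix : ∀ y → p y ≢ y
    p-edge : ∀ y → Edge H y (p y)

perfect-matching⇒involution : ∀ {N} (H : Graph N) → PerfectMatching H → MatchingInvolution H
perfect-matching⇒involution {N} H pm = record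
  { p = p ; p-invol = p-invol ; p-nofix = p-nofix ; p-edge = λ y → M-edge y (p y) (matched y) }
  where
  open PerfectMatching pm
  p : Fin N → Fin N
  p y = proj₁ (unique y)
  matched : ∀ y → M y (p y)
  matched y = proj₁ (proj₂ (unique y))
  p-invol : ∀ y → p (p y) ≡ y
  p-invol y = sym (proj₂ (proj₂ (unique (p y))) y (M-sym y (p y) (matched y)))
  p-nofix : ∀ y → p y ≢ y
  p-nofix y e = subst T (Graph.irrefl H y) (subst (Edge H y) e (M-edge y (p y) (matched y)))

TreesMatchable : ∀ {N} → Graph N → Set₁
TreesMatchable {N} G = ∀ (Tr : Graph N) → SpanningTree Tr G → PerfectMatching Tr

-- Under this hypothesis every connected spanning subgraph H of G has a
-- matching involution, since a spanning tree of H is one of G.  (Opaque: only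
-- the existence of the involution is used, and unfolding it is expensive.)
opaque
  subgraph-involution : ∀ {n} (G : Graph (suc n)) → TreesMatchable G →
    (H : Graph (suc n)) → Connected H → SpanningSub H G → MatchingInvolution H
  subgraph-involution G matchable H conn H⊆G with spanning-tree H conn
  ... | Tr , Tr⊆H , tree =
    record { p = p ; p-invol = p-invol ; p-nofix = p-nofix ; p-edge = λ y → Tr⊆H y (p y) (p-edge y) }
    where
    inv : MatchingInvolution Tr
    inv = perfect-matching⇒involution Tr (matchable Tr ((λ x y e → H⊆G x y (Tr⊆H x y e)) , tree))
    open MatchingInvolution inv

ClosedExcept : ∀ {N} → Graph N → (Fin N → Bool) → Fin N → Set
ClosedExcept H S e = ∀ y w → T (S y) → Edge H y w → T (S w) ⊎ w ≡ e

module _ {N : ℕ} {H : Graph N} (inv : MatchingInvolution H) where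
  open MatchingInvolution inv

  -- If the only exit e of S is not matched into S, S is a union of matched
  -- pairs and so has even size.
  closed-except-even : ∀ S e → ClosedExcept H S e → ¬ T (S (p e)) → Even (count S)
  closed-except-even S e closed pe∉S = InvolutionParity.closed-even p p-invol p-nofix S p-closed
    where
    p-closed : ∀ y → T (S y) → T (S (p y))
    p-closed y y∈S with closed y (p y) y∈S (p-edge y)
    ... | inj₁ py∈S = py∈S
    ... | inj₂ py≡e = ⊥-elim (pe∉S (subst (T ∘ S) (trans (sym (p-invol y)) (cong p py≡e)) y∈S))

  -- Two disjoint sets of odd size cannot both be closed except at the same
  -- vertex e: the partner p e lies outside one of them.
  two-odd-sets : ∀ S₁ S₂ e → (∀ y → T (S₁ y) → ¬ T (S₂ y)) →
    ClosedExcept H S₁ e → ClosedExcept H S₂ e →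
    ¬ Even (count S₁) → ¬ Even (count S₂) → ⊥
  two-odd-sets S₁ S₂ e disjoint closed₁ closed₂ odd₁ odd₂ with T? (S₁ (p e))
  ... | yes pe∈S₁ = odd₂ (closed-except-even S₂ e closed₂ (disjoint (p e) pe∈S₁))
  ... | no pe∉S₁ = odd₁ (closed-except-even S₁ e closed₁ pe∉S₁)

∸-split : ∀ {a b c} → a ≤ b → b ≤ c → c ∸ a ≡ (b ∸ a) + (c ∸ b)
∸-split {a} {b} {c} a≤b b≤c = +-cancelʳ-≡ a _ _ (begin
  c ∸ a + a                ≡⟨ m∸n+n≡m (≤-trans a≤b b≤c) ⟩
  c                        ≡⟨ sym (m∸n+n≡m b≤c) ⟩
  c ∸ b + b                ≡⟨ cong (c ∸ b +_) (sym (m∸n+n≡m a≤b)) ⟩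
  c ∸ b + (b ∸ a + a)      ≡⟨ sym (+-assoc (c ∸ b) _ a) ⟩
  c ∸ b + (b ∸ a) + a      ≡⟨ cong (_+ a) (+-comm (c ∸ b) _) ⟩
  b ∸ a + (c ∸ b) + a      ∎)
  where open ≡-Reasoning

∸-suc : ∀ {x p y} → y ≡ suc p → x ≤ p → y ∸ x ≡ (p ∸ x) + 1
∸-suc {x} {p} refl le = trans (+-∸-assoc 1 le) (+-comm 1 (p ∸ x))

-- For a nonseparable G, a vertex v and a neighbour a of v, the graph G - v is
-- connected, so BFS from a inside G - v gives a spanning tree of G - v rooted
-- at a.
module TreeAvoiding {n : ℕ} (G : Graph (suc n)) (nonsep : Nonseparable G)
    (v a : Fin (suc n)) (a≢v : a ≢ v) where
  N : ℕ
  N = suc n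

  avoid-v : Fin N → Fin N → Bool
  avoid-v x y = (adj G x y ∧ not (x == v)) ∧ not (y == v)

  open BFS avoid-v a public

  avoid-v-intro : ∀ x y → EdgeMinus G v x y → T (avoid-v x y)
  avoid-v-intro x y (e , x≢v , y≢v) = ∧-intro (∧-intro e (≢⇒not== x≢v)) (≢⇒not== y≢v)

  -- G - v is connected, since v is not a cut vertex
  reached : ∀ w → w ≢ v → Reached w
  reached w w≢v with reached? w
  ... | yes t = t
  ... | no nt = ⊥-elim (proj₂ nonsep v (a , w , a≢v , w≢v , proj₁ nonsep a w ,
                  λ wk → nt (reached-walk (mapʷ avoid-v-intro wk) root-reached)))

  v-unreached : ¬ Reached v
  v-unreached = unreached v (a≢v ∘ sym)
    (λ u t → not-elim (∧-snd {adj G u v ∧ not (u == v)} t) (==-refl v))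

  par-≢v : ∀ w → w ≢ v → w ≢ a → par w ≢ v
  par-≢v w w≢v w≢a e = v-unreached (subst Reached e (par-reached w (reached w w≢v) w≢a))

  par-edge : ∀ w → w ≢ v → w ≢ a → Edge G (par w) w
  par-edge w w≢v w≢a = ∧-fst {adj G (par w) w} (∧-fst {adj G (par w) w ∧ not (par w == v)}
    (proj₁ (par-ok w (reached w w≢v) w≢a)))

  rank-par : ∀ w → w ≢ v → w ≢ a → rank w ≡ suc (rank (par w))
  rank-par w w≢v w≢a = ≤-antisym
    (rank-adj (par w) w (reached (par w) (par-≢v w w≢v w≢a)) (proj₁ (par-ok w (reached w w≢v) w≢a)))
    (proj₂ (par-ok w (reached w w≢v) w≢a))

  rank-a : rank a ≡ 0
  rank-a = rank-root

  rank-0⇒a : ∀ w → w ≢ v → rank w ≡ 0 → w ≡ a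
  rank-0⇒a w w≢v = rank-0 w (reached w w≢v)

  rank≢0⇒≢a : ∀ {y} → rank y ≢ 0 → y ≢ a
  rank≢0⇒≢a ne refl = ne rank-a

  par° : Fin N → Fin N
  par° y = if y == a then a else par y

  par°-a : par° a ≡ a
  par°-a rewrite T⇒true (==-refl a) = refl

  par°-≢a : ∀ y → y ≢ a → par° y ≡ par y
  par°-≢a y ne rewrite ¬T⇒false (λ t → ne (==⇒≡ {x = y} t)) = refl

  up : ℕ → Fin N → Fin N
  up zero y = y
  up (suc m) y = par° (up m y)

  up-+ : ∀ m k y → up m (up k y) ≡ up (m + k) y
  up-+ zero k y = refl
  up-+ (suc m) k y = cong par° (up-+ m k y)

  up-par : ∀ m y → y ≢ a → up m (par y) ≡ up (m + 1) y
  up-par m y y≢a = trans (cong (up m) (sym (par°-≢a y y≢a))) (up-+ m 1 y)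

  up-≢v : ∀ m y → y ≢ v → up m y ≢ v
  up-≢v zero y y≢v = y≢v
  up-≢v (suc m) y y≢v with up m y ≟ a | up-≢v m y y≢v
  ... | yes e | _ rewrite e | par°-a = a≢v
  ... | no ne | ≢v rewrite par°-≢a (up m y) ne = par-≢v (up m y) ≢v ne

  up-rank : ∀ m y → y ≢ v → rank (up m y) ≡ rank y ∸ m
  up-rank zero y y≢v = refl
  up-rank (suc m) y y≢v = trans (rank-par° (up m y) (up-≢v m y y≢v))
    (trans (cong pred (up-rank m y y≢v)) (pred[m∸n]≡m∸[1+n] (rank y) m))
    where
    rank-par° : ∀ y → y ≢ v → rank (par° y) ≡ pred (rank y)
    rank-par° y y≢v with y ≟ a
    ... | yes refl rewrite par°-a | rank-a = refl
    ... | no ne = trans (cong rank (par°-≢a y ne)) (cong pred (sym (rank-par y y≢v ne)))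

  -- x is an ancestor of y in the tree (reflexively): climbing from y by the
  -- rank difference reaches x
  Anc : Fin N → Fin N → Set
  Anc x y = up (rank y ∸ rank x) y ≡ x

  anc? : Fin N → Fin N → Bool
  anc? x y = up (rank y ∸ rank x) y == x

  anc-dec : ∀ x y → Dec (Anc x y)
  anc-dec x y = up (rank y ∸ rank x) y ≟ x

  anc-refl : ∀ x → Anc x x
  anc-refl x rewrite n∸n≡0 (rank x) = refl

  anc-≢v : ∀ {x y} → y ≢ v → Anc x y → x ≢ v
  anc-≢v {x} {y} y≢v e x≡v = up-≢v (rank y ∸ rank x) y y≢v (trans e x≡v)

  anc-rank : ∀ {x y} → y ≢ v → Anc x y → rank x ≤ rank y
  anc-rank {x} {y} y≢v e = subst (_≤ rank y)
    (trans (sym (up-rank (rank y ∸ rank x) y y≢v)) (cong rank e)) (m∸n≤m (rank y) (rank y ∸ rank x))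

  anc-same-rank : ∀ {x y} → Anc x y → rank x ≡ rank y → x ≡ y
  anc-same-rank {x} {y} e er rewrite er | n∸n≡0 (rank y) = sym e

  anc-antisym : ∀ {x y} → x ≢ v → y ≢ v → Anc x y → Anc y x → x ≡ y
  anc-antisym x≢v y≢v e₁ e₂ = anc-same-rank e₁ (≤-antisym (anc-rank y≢v e₁) (anc-rank x≢v e₂))

  anc-trans : ∀ {x y z} → z ≢ v → Anc x y → Anc y z → Anc x z
  anc-trans {x} {y} {z} z≢v x-y y-z = begin
    up (rank z ∸ rank x) z                            ≡⟨ cong (λ m → up m z) (∸-split x≤y y≤z) ⟩
    up ((rank y ∸ rank x) + (rank z ∸ rank y)) z      ≡⟨ sym (up-+ (rank y ∸ rank x) (rank z ∸ rank y) z) ⟩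
    up (rank y ∸ rank x) (up (rank z ∸ rank y) z)     ≡⟨ cong (up (rank y ∸ rank x)) y-z ⟩
    up (rank y ∸ rank x) y                            ≡⟨ x-y ⟩
    x                                                 ∎
    where
    open ≡-Reasoning
    x≤y : rank x ≤ rank y
    x≤y = anc-rank (anc-≢v z≢v y-z) x-y
    y≤z : rank y ≤ rank z
    y≤z = anc-rank z≢v y-z

  anc-comparable : ∀ {x y z} → z ≢ v → Anc x z → Anc y z → rank x ≤ rank y → Anc x y
  anc-comparable {x} {y} {z} z≢v x-z y-z x≤y = begin
    up (rank y ∸ rank x) y                            ≡⟨ cong (up (rank y ∸ rank x)) (sym y-z) ⟩
    up (rank y ∸ rank x) (up (rank z ∸ rank y) z)     ≡⟨ up-+ (rank y ∸ rank x) (rank z ∸ rank y) z ⟩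
    up ((rank y ∸ rank x) + (rank z ∸ rank y)) z      ≡⟨ cong (λ m → up m z) (sym (∸-split x≤y (anc-rank z≢v y-z))) ⟩
    up (rank z ∸ rank x) z                            ≡⟨ x-z ⟩
    x                                                 ∎
    where open ≡-Reasoning

  anc-par : ∀ {x y} → y ≢ v → y ≢ a → Anc x (par y) → Anc x y
  anc-par {x} {y} y≢v y≢a e =
    trans (cong (λ m → up m y) (∸-suc (rank-par y y≢v y≢a) (anc-rank (par-≢v y y≢v y≢a) e)))
      (trans (sym (up-par (rank (par y) ∸ rank x) y y≢a)) e)

  anc-proper : ∀ {x y} → y ≢ v → Anc x y → x ≢ y → y ≢ a × Anc x (par y)
  anc-proper {x} {y} y≢v e x≢y = y≢a , trans (up-par (rank (par y) ∸ rank x) y y≢a)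
      (trans (cong (λ m → up m y) (sym (∸-suc (rank-par y y≢v y≢a) x≤par))) e)
    where
    x<y : rank x < rank y
    x<y with m≤n⇒m<n∨m≡n (anc-rank y≢v e)
    ... | inj₁ l = l
    ... | inj₂ q = ⊥-elim (x≢y (anc-same-rank e q))
    y≢a : y ≢ a
    y≢a = rank≢0⇒≢a (λ q → n≮0 (subst (rank x <_) q x<y))
    x≤par : rank x ≤ rank (par y)
    x≤par = ≤-pred (subst (rank x <_) (rank-par y y≢v y≢a) x<y)

  anc-of-root : ∀ {x} → Anc x a → x ≡ a
  anc-of-root {x} e rewrite rank-a | 0∸n≡0 (rank x) = sym e

  -- the ancestor of y at depth 1, i.e. the child of the root above y, and
  -- its defining properties
  top : Fin N → Fin N
  top y = up (rank y ∸ 1) y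

  record Top (y : Fin N) : Set where
    field
      top-anc : Anc (top y) y
      top-≢a : top y ≢ a
      top-par : par (top y) ≡ a

  top-spec : ∀ y → y ≢ v → y ≢ a → Top y
  top-spec y y≢v y≢a = record { top-anc = anc ; top-≢a = t≢a ; top-par = pa }
    where
    y≥1 : 1 ≤ rank y
    y≥1 with rank y in eq
    ... | zero = ⊥-elim (y≢a (rank-0⇒a y y≢v eq))
    ... | suc _ = s≤s z≤n
    rank-top : rank (top y) ≡ 1
    rank-top = trans (up-rank (rank y ∸ 1) y y≢v) (m∸[m∸n]≡n y≥1)
    anc : Anc (top y) y
    anc rewrite rank-top = refl
    t≢v : top y ≢ v
    t≢v = up-≢v (rank y ∸ 1) y y≢v
    t≢a : top y ≢ a
    t≢a = rank≢0⇒≢a (λ q → 1+n≢0 (trans (sym rank-top) q))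
    pa : par (top y) ≡ a
    pa = rank-0⇒a _ (par-≢v _ t≢v t≢a) (suc-injective (trans (sym (rank-par _ t≢v t≢a)) rank-top))

  desc : Fin N → Fin N → Bool
  desc x z = anc? x z ∧ not (z == v)

  desc-intro : ∀ {x z} → Anc x z → z ≢ v → T (desc x z)
  desc-intro e z≢v = ∧-intro (≡⇒== e) (≢⇒not== z≢v)

  desc-elim : ∀ {x z} → T (desc x z) → Anc x z × z ≢ v
  desc-elim {x} {z} t = ==⇒≡ (∧-fst {anc? x z} t) , not==⇒≢ (∧-snd {anc? x z} t)

  nondesc : Fin N → Fin N → Bool
  nondesc x z = not (anc? x z) ∧ not (z == v)

  nondesc-intro : ∀ {x z} → ¬ Anc x z → z ≢ v → T (nondesc x z)
  nondesc-intro ne z≢v = ∧-intro (not-intro (ne ∘ ==⇒≡)) (≢⇒not== z≢v)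

  nondesc-elim : ∀ {x z} → T (nondesc x z) → ¬ Anc x z × z ≢ v
  nondesc-elim {x} {z} t =
    not-elim (∧-fst {not (anc? x z)} t) ∘ ≡⇒== , not==⇒≢ (∧-snd {not (anc? x z)} t)

  -- Rewiring the tree: delete the parent edges of the vertices in `cuts` and
  -- join v to the vertices in `nbrs`.  C collects the vertices without a
  -- parent edge in the result H, which is a spanning subgraph of G.
  module Rewired (cuts nbrs : List (Fin N)) (v~nbrs : ∀ w → w ∈ nbrs → Edge G v w) where
    C : Fin N → Bool
    C = ⟨ a ∷ v ∷ cuts ⟩

    cut∈C : ∀ {z} → z ∈ cuts → T (C z)
    cut∈C m = ⟨⟩-intro (a ∷ v ∷ cuts) (there (there m))

    ∉C⇒≢a : ∀ {u} → ¬ T (C u) → u ≢ a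
    ∉C⇒≢a u∉C refl = u∉C (⟨⟩-intro (a ∷ v ∷ cuts) (here refl))

    ∉C⇒≢v : ∀ {u} → ¬ T (C u) → u ≢ v
    ∉C⇒≢v u∉C refl = u∉C (⟨⟩-intro (a ∷ v ∷ cuts) (there (here refl)))

    arc : Fin N → Fin N → Bool
    arc u w = (not (C u) ∧ (par u == w)) ∨ ((u == v) ∧ ⟨ nbrs ⟩ w)

    arc-elim : ∀ u w → T (arc u w) → (¬ T (C u) × par u ≡ w) ⊎ (u ≡ v × w ∈ nbrs)
    arc-elim u w t with ∨-elim {not (C u) ∧ (par u == w)} t
    ... | inj₁ x = inj₁ (not-elim (∧-fst {not (C u)} x) , ==⇒≡ (∧-snd {not (C u)} x))
    ... | inj₂ y = inj₂ (==⇒≡ (∧-fst {u == v} y) , ⟨⟩-elim nbrs w (∧-snd {u == v} y))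

    arc-irrefl : ∀ u → arc u u ≡ false
    arc-irrefl u = ¬T⇒false λ t → loop (arc-elim u u t)
      where
      loop : ¬ ((¬ T (C u) × par u ≡ u) ⊎ (u ≡ v × u ∈ nbrs))
      loop (inj₁ (u∉C , e)) = <-irrefl (cong rank e)
        (subst (rank (par u) <_) (sym (rank-par u (∉C⇒≢v u∉C) (∉C⇒≢a u∉C))) ≤-refl)
      loop (inj₂ (refl , m)) = edge-≢ G (v~nbrs v m) refl

    H : Graph N
    H = record
      { adj = λ x y → arc x y ∨ arc y x
      ; sym = λ x y → ∨-comm (arc x y) (arc y x)
      ; irrefl = λ x → cong (λ b → b ∨ b) (arc-irrefl x) }

    H-edge-elim : ∀ y w → Edge H y w →
      (¬ T (C y) × par y ≡ w) ⊎ (¬ T (C w) × par w ≡ y) ⊎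
      (y ≡ v × w ∈ nbrs) ⊎ (w ≡ v × y ∈ nbrs)
    H-edge-elim y w t with ∨-elim {arc y w} t
    ... | inj₁ x with arc-elim y w x
    ... | inj₁ q = inj₁ q
    ... | inj₂ q = inj₂ (inj₂ (inj₁ q))
    H-edge-elim y w t | inj₂ x with arc-elim w y x
    ... | inj₁ q = inj₂ (inj₁ q)
    ... | inj₂ q = inj₂ (inj₂ (inj₂ q))

    H⊆G : SpanningSub H G
    H⊆G y w t with H-edge-elim y w t
    ... | inj₁ (y∉C , refl) = edge-sym G _ _ (par-edge y (∉C⇒≢v y∉C) (∉C⇒≢a y∉C))
    ... | inj₂ (inj₁ (w∉C , refl)) = par-edge w (∉C⇒≢v w∉C) (∉C⇒≢a w∉C)
    ... | inj₂ (inj₂ (inj₁ (refl , m))) = v~nbrs w m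
    ... | inj₂ (inj₂ (inj₂ (refl , m))) = edge-sym G _ _ (v~nbrs y m)

    tree-arc : ∀ u → ¬ T (C u) → Edge H u (par u)
    tree-arc u u∉C = ∨-introˡ (∨-introˡ {not (C u) ∧ (par u == par u)}
      (∧-intro (not-intro u∉C) (==-refl (par u))))

    step-to-v : ∀ w → w ∈ nbrs → Walk (Edge H) w v
    step-to-v w m = edge-sym H v w v~w ∷ []
      where
      v~w : Edge H v w
      v~w = ∨-introˡ (∨-introʳ {not (C v) ∧ (par v == w)} (∧-intro (==-refl v) (⟨⟩-intro nbrs m)))

    record Climb (u : Fin N) : Set where
      field
        stop : Fin N
        stop∈C : T (C stop)
        stop-anc : Anc stop u
        climb-walk : Walk (Edge H) u stop
        deepest : ∀ z → T (C z) → Anc z u → Anc z stop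

    climb-from : ∀ m u → rank u ≤ m → u ≢ v → Climb u
    climb-from m u le u≢v with T? (C u)
    ... | yes u∈C = record
      { stop = u ; stop∈C = u∈C ; stop-anc = anc-refl u ; climb-walk = [] ; deepest = λ _ _ e → e }
    climb-from zero u le u≢v | no u∉C = ⊥-elim (∉C⇒≢a u∉C (rank-0⇒a u u≢v (n≤0⇒n≡0 le)))
    climb-from (suc m) u le u≢v | no u∉C = record
      { stop = stop ; stop∈C = stop∈C
      ; stop-anc = anc-par u≢v u≢a stop-anc
      ; climb-walk = tree-arc u u∉C ∷ climb-walk
      ; deepest = λ z z∈C e → deepest z z∈C (proj₂ (anc-proper u≢v e λ { refl → u∉C z∈C })) }
      where
      u≢a : u ≢ a
      u≢a = ∉C⇒≢a u∉C
      open Climb (climb-from m (par u)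
        (≤-pred (subst (_≤ suc m) (rank-par u u≢v u≢a) le)) (par-≢v u u≢v u≢a))

    opaque
      climb : ∀ u → u ≢ v → Climb u
      climb u = climb-from (rank u) u ≤-refl

    connected-if : Walk (Edge H) a v → (∀ z → z ∈ cuts → Walk (Edge H) z v) → Connected H
    connected-if a-to-v cut-to-v = connected-via H v to-v
      where
      to-v : ∀ u → Walk (Edge H) u v
      to-v u with u ≟ v
      ... | yes refl = []
      ... | no u≢v = climb-walk ++ʷ from-stop (⟨⟩-elim (a ∷ v ∷ cuts) stop stop∈C)
        where
        open Climb (climb u u≢v)
        from-stop : stop ∈ a ∷ v ∷ cuts → Walk (Edge H) stop v
        from-stop (here stop≡a) = subst (λ s → Walk (Edge H) s v) (sym stop≡a) a-to-v
        from-stop (there (here stop≡v)) = ⊥-elim (anc-≢v u≢v stop-anc stop≡v)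
        from-stop (there (there m)) = cut-to-v stop m

    desc-edge : ∀ {x y w} → Anc x y → y ≢ v → Edge H y w →
      (Anc x w × w ≢ v) ⊎ (w ≡ v × y ∈ nbrs) ⊎ (y ≡ x × ¬ T (C x) × par x ≡ w)
    desc-edge {x} {y} {w} x-y y≢v e with H-edge-elim y w e
    ... | inj₁ (y∉C , refl) with x ≟ y
    ...   | yes refl = inj₂ (inj₂ (refl , y∉C , refl))
    ...   | no x≢y = inj₁ (proj₂ (anc-proper y≢v x-y x≢y) , par-≢v y y≢v (∉C⇒≢a y∉C))
    desc-edge x-y y≢v e | inj₂ (inj₁ (w∉C , refl)) =
      inj₁ (anc-par (∉C⇒≢v w∉C) (∉C⇒≢a w∉C) x-y , ∉C⇒≢v w∉C)
    desc-edge x-y y≢v e | inj₂ (inj₂ (inj₁ (y≡v , _))) = ⊥-elim (y≢v y≡v)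
    desc-edge x-y y≢v e | inj₂ (inj₂ (inj₂ (w≡v , m))) = inj₂ (inj₁ (w≡v , m))

    desc-closed : ∀ x → x ∈ cuts → ClosedExcept H (desc x) v
    desc-closed x x∈cuts y w y∈S e with desc-elim y∈S
    ... | x-y , y≢v with desc-edge x-y y≢v e
    ... | inj₁ (x-w , w≢v) = inj₁ (desc-intro x-w w≢v)
    ... | inj₂ (inj₁ (w≡v , _)) = inj₂ w≡v
    ... | inj₂ (inj₂ (_ , x∉C , _)) = ⊥-elim (x∉C (cut∈C x∈cuts))

    nondesc-closed : ∀ x → x ∈ cuts → ClosedExcept H (nondesc x) v
    nondesc-closed x x∈cuts y w y∈S e with nondesc-elim y∈S | H-edge-elim y w e
    ... | ¬x-y , y≢v | inj₁ (y∉C , refl) =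
      inj₁ (nondesc-intro (¬x-y ∘ anc-par y≢v (∉C⇒≢a y∉C)) (par-≢v y y≢v (∉C⇒≢a y∉C)))
    ... | ¬x-y , y≢v | inj₂ (inj₁ (w∉C , refl)) =
      inj₁ (nondesc-intro
        (λ x-w → ¬x-y (proj₂ (anc-proper (∉C⇒≢v w∉C) x-w λ { refl → w∉C (cut∈C x∈cuts) })))
        (∉C⇒≢v w∉C))
    ... | _ , y≢v | inj₂ (inj₂ (inj₁ (y≡v , _))) = ⊥-elim (y≢v y≡v)
    ... | _ | inj₂ (inj₂ (inj₂ (w≡v , _))) = inj₂ w≡v

DegreeAtMost2 : ∀ {N} → Graph N → Set
DegreeAtMost2 G = ∀ v a b c → Edge G v a → Edge G v b → Edge G v c → a ≢ b → a ≢ c → b ≢ c → ⊥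

module Setting {n : ℕ} (G : Graph (suc n)) (nonsep : Nonseparable G) (matchable : TreesMatchable G) where
  N : ℕ
  N = suc n

  involution : (H : Graph N) → Connected H → SpanningSub H G → MatchingInvolution H
  involution = subgraph-involution G matchable

  -- G itself is matched, so it has an even number of vertices.
  even-order : Even N
  even-order = subst Even count-all
    (InvolutionParity.closed-even p p-invol p-nofix (λ _ → true) (λ _ _ → tt))
    where open MatchingInvolution (involution G (proj₁ nonsep) (λ _ _ e → e))

  module AtVertex (v a : Fin N) (v~a : Edge G v a) where
    open TreeAvoiding G nonsep v a (edge-≢ G v~a) public hiding (N)

    -- The tree plus one edge v x: a spanning tree of G in which v is a leaf,
    -- so its matching pairs v with x.
    module Pendant (x : Fin N) (v~x : Edge G v x) where
      x≢v : x ≢ v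
      x≢v = edge-≢ G v~x

      v~x-only : ∀ w → w ∈ x ∷ [] → Edge G v w
      v~x-only w (here refl) = v~x

      open Rewired [] (x ∷ []) v~x-only public

      -- the root a climbs down to x and then steps to v
      open Climb (climb x x≢v)

      a-to-v : Walk (Edge H) a v
      a-to-v with ⟨⟩-elim (a ∷ v ∷ []) stop stop∈C
      ... | here stop≡a = subst (λ s → Walk (Edge H) s v) stop≡a
              (reverseʷ (edge-sym H) climb-walk ++ʷ step-to-v x (here refl))
      ... | there (here stop≡v) = ⊥-elim (anc-≢v x≢v stop-anc stop≡v)

      matching : MatchingInvolution H
      matching = involution H (connected-if a-to-v (λ _ ())) H⊆G

      open MatchingInvolution matching public

      p-v : p v ≡ x
      p-v with H-edge-elim v (p v) (p-edge v)
      ... | inj₁ (v∉C , _) = ⊥-elim (∉C⇒≢v v∉C refl)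
      ... | inj₂ (inj₁ (pv∉C , e)) = ⊥-elim (par-≢v (p v) (∉C⇒≢v pv∉C) (∉C⇒≢a pv∉C) e)
      ... | inj₂ (inj₂ (inj₁ (_ , here e))) = e
      ... | inj₂ (inj₂ (inj₂ (e , _))) = ⊥-elim (p-nofix v e)

      p-x : p x ≡ v
      p-x = trans (cong p (sym p-v)) (p-invol v)

    -- A neighbour x ≢ a of v has an odd number of descendants: in the pendant
    -- tree at x, the descendants other than x are matched among themselves.
    odd-desc : ∀ x → x ≢ a → Edge G v x → ¬ Even (count (desc x))
    odd-desc x x≢a v~x even = even⇒¬odd even-rest
      (subst Even (count-remove (desc x) x (desc-intro (anc-refl x) x≢v)) even)
      where
      open Pendant x v~x
      rest : Fin N → Bool
      rest = remove (desc x) x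
      closed : ClosedExcept H rest x
      closed y w y∈S e with remove-elim (desc x) y∈S
      ... | y∈D , y≢x with desc-elim y∈D
      ... | x-y , y≢v with desc-edge x-y y≢v e
      ... | inj₂ (inj₁ (_ , here y≡x)) = ⊥-elim (y≢x y≡x)
      ... | inj₂ (inj₂ (y≡x , _)) = ⊥-elim (y≢x y≡x)
      ... | inj₁ (x-w , w≢v) with w ≟ x
      ...   | yes w≡x = inj₂ w≡x
      ...   | no w≢x = inj₁ (remove-intro (desc x) (desc-intro x-w w≢v) w≢x)
      even-rest : Even (count rest)
      even-rest = closed-except-even matching rest x closed
        λ t → proj₂ (desc-elim (proj₁ (remove-elim (desc x) t))) p-x

    -- For b ≢ a, the subtree hanging from the child of the root above b has an
    -- even number of vertices: in the pendant tree at a, its only exit is the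
    -- root a, which is matched with v.
    even-desc-top : ∀ b → b ≢ v → b ≢ a → Even (count (desc (top b)))
    even-desc-top b b≢v b≢a = closed-except-even matching (desc d) a closed d∌pa
      where
      open Pendant a v~a
      open Top (top-spec b b≢v b≢a)
      d : Fin N
      d = top b
      d∌pa : ¬ T (desc d (p a))
      d∌pa t = proj₂ (desc-elim t) p-x
      closed : ClosedExcept H (desc d) a
      closed y w y∈D e with desc-elim y∈D
      ... | d-y , y≢v with desc-edge d-y y≢v e
      ... | inj₁ (d-w , w≢v) = inj₁ (desc-intro d-w w≢v)
      ... | inj₂ (inj₁ (_ , here refl)) = ⊥-elim (top-≢a (anc-of-root d-y))
      ... | inj₂ (inj₂ (_ , _ , pd≡w)) = inj₂ (trans (sym pd≡w) top-par)

    -- Consequently the vertices other than v outside that subtree are odd in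
    -- number, as the order of G is even.
    odd-nondesc-top : ∀ b → b ≢ v → b ≢ a → ¬ Even (count (nondesc (top b)))
    odd-nondesc-top b b≢v b≢a even = even⇒¬odd (even-+ (even-desc-top b b≢v b≢a) even)
      (subst Even order even-order)
      where
      order : N ≡ suc (count (desc (top b)) + count (nondesc (top b)))
      order = trans (sym count-all) (trans (count-remove (λ _ → true) v tt)
                (cong suc (sym (count-split (anc? (top b)) (λ z → not (z == v))))))

    -- Join v
    -- to all three and cut the tree so that two disjoint odd vertex sets are
    -- closed in the resulting graph except at v.
    module ThreeNeighbours (b c : Fin N) (v~b : Edge G v b) (v~c : Edge G v c)
        (a≢b : a ≢ b) (a≢c : a ≢ c) (b≢c : b ≢ c) where
      nbrs : List (Fin N)
      nbrs = a ∷ b ∷ c ∷ []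

      v~nbrs : ∀ w → w ∈ nbrs → Edge G v w
      v~nbrs w (here refl) = v~a
      v~nbrs w (there (here refl)) = v~b
      v~nbrs w (there (there (here refl))) = v~c

      b≢v : b ≢ v
      b≢v = edge-≢ G v~b
      c≢v : c ≢ v
      c≢v = edge-≢ G v~c

      -- b and c incomparable: cut above b and c; their subtrees are odd.
      incomparable : ¬ Anc b c → ¬ Anc c b → ⊥
      incomparable b-̸c c-̸b =
        two-odd-sets (involution H connected H⊆G) (desc b) (desc c) v disjoint
          (desc-closed b (here refl)) (desc-closed c (there (here refl)))
          (odd-desc b (a≢b ∘ sym) v~b) (odd-desc c (a≢c ∘ sym) v~c)
        where
        open Rewired (b ∷ c ∷ []) nbrs v~nbrs
        connected : Connected H
        connected = connected-if (step-to-v a (here refl)) λ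
          { z (here refl) → step-to-v b (there (here refl))
          ; z (there (here refl)) → step-to-v c (there (there (here refl))) }
        disjoint : ∀ y → T (desc b y) → ¬ T (desc c y)
        disjoint y y∈b y∈c with desc-elim y∈b | desc-elim y∈c
        ... | b-y , y≢v | c-y , _ with ≤-total (rank b) (rank c)
        ... | inj₁ le = b-̸c (anc-comparable y≢v b-y c-y le)
        ... | inj₂ le = c-̸b (anc-comparable y≢v c-y b-y le)

      -- b an ancestor of c: cut above c and above d = top b.  The subtree of c
      -- is odd, and so is the set of vertices other than v outside the
      -- subtree of d.
      nested : Anc b c → ⊥
      nested b-c =
        two-odd-sets (involution H connected H⊆G) (desc c) (nondesc d) v disjoint
          (desc-closed c (there (here refl))) (nondesc-closed d (here refl))
          (odd-desc c (a≢c ∘ sym) v~c) (odd-nondesc-top b b≢v (a≢b ∘ sym))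
        where
        open Top (top-spec b b≢v (a≢b ∘ sym))
        d : Fin N
        d = top b
        d-c : Anc d c
        d-c = anc-trans c≢v top-anc b-c
        open Rewired (d ∷ c ∷ []) nbrs v~nbrs
        -- d reaches v through b: climbing from b stops exactly at d
        open Climb (climb b b≢v)
        d-stop : Anc d stop
        d-stop = deepest d (cut∈C (here refl)) top-anc
        d-to-v : Walk (Edge H) d v
        d-to-v with ⟨⟩-elim (a ∷ v ∷ d ∷ c ∷ []) stop stop∈C
        ... | here stop≡a = ⊥-elim (top-≢a (anc-of-root (subst (Anc d) stop≡a d-stop)))
        ... | there (here stop≡v) = ⊥-elim (anc-≢v b≢v stop-anc stop≡v)
        ... | there (there (here stop≡d)) = subst (λ s → Walk (Edge H) s v) stop≡d
                (reverseʷ (edge-sym H) climb-walk ++ʷ step-to-v b (there (here refl)))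
        ... | there (there (there (here stop≡c))) =
                ⊥-elim (b≢c (anc-antisym b≢v c≢v b-c (subst (λ s → Anc s b) stop≡c stop-anc)))
        connected : Connected H
        connected = connected-if (step-to-v a (here refl)) λ
          { z (here refl) → d-to-v
          ; z (there (here refl)) → step-to-v c (there (there (here refl))) }
        disjoint : ∀ y → T (desc c y) → ¬ T (nondesc d y)
        disjoint y y∈c y∉d with desc-elim y∈c | nondesc-elim y∉d
        ... | c-y , y≢v | ¬d-y , _ = ¬d-y (anc-trans y≢v d-c c-y)

    three-neighbours : ∀ b c → Edge G v b → Edge G v c → a ≢ b → a ≢ c → b ≢ c → ⊥
    three-neighbours b c v~b v~c a≢b a≢c b≢c with anc-dec b c | anc-dec c b
    ... | yes b-c | _ = ThreeNeighbours.nested b c v~b v~c a≢b a≢c b≢c b-c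
    ... | no _ | yes c-b = ThreeNeighbours.nested c b v~c v~b a≢c a≢b (b≢c ∘ sym) c-b
    ... | no b-̸c | no c-̸b = ThreeNeighbours.incomparable b c v~b v~c a≢b a≢c b≢c b-̸c c-̸b

  degree-≤2 : DegreeAtMost2 G
  degree-≤2 v a b c v~a = AtVertex.three-neighbours v a v~a b c

-- An injective map from Fin (suc n) to itself is onto: a missed value j
-- could be punched out, giving an injection of Fin (suc n) into Fin n.
-- (Opaque: only the existence of preimages is used.)
opaque
  injective⇒onto : ∀ {n} (f : Fin (suc n) → Fin (suc n)) → (∀ x y → f x ≡ f y → x ≡ y) →
    ∀ j → Σ (Fin (suc n)) λ i → f i ≡ j
  injective⇒onto {n} f inj j with any? (λ i → f i ≟ j)
  ... | yes found = found
  ... | no missed = ⊥-elim (<-irrefl refl (injective⇒≤ {f = g} g-inj))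
    where
    g : Fin (suc n) → Fin n
    g i = punchOut {i = j} (λ e → missed (i , sym e))
    g-inj : ∀ {x y} → g x ≡ g y → x ≡ y
    g-inj {x} {y} e =
      inj x y (punchOut-injective {i = j} (λ e → missed (x , sym e)) (λ e → missed (y , sym e)) e)

injective⇒↔ : ∀ {n} (f : Fin (suc n) → Fin (suc n)) → (∀ x y → f x ≡ f y → x ≡ y) →
  Σ (Fin (suc n) ↔ Fin (suc n)) λ φ → ∀ x → Inverse.to φ x ≡ f x
injective⇒↔ {n} f inj = mk↔ₛ′ f g (λ y → proj₂ (injective⇒onto f inj y))
                             (λ x → inj _ _ (proj₂ (injective⇒onto f inj (f x)))) , λ x → refl
  where
  g : Fin (suc n) → Fin (suc n)
  g y = proj₁ (injective⇒onto f inj y)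

CycleAdj : ℕ → ℕ → ℕ → Set
CycleAdj k i j = j ≡ (i + 1) % suc k ⊎ i ≡ (j + 1) % suc k

cycAdj-elim : ∀ k (i j : Fin (suc k)) → T (cycAdj k i j) → CycleAdj k (toℕ i) (toℕ j)
cycAdj-elim k i j t with ∨-elim {toℕ j ≡ᵇ (toℕ i + 1) % suc k} t
... | inj₁ q = inj₁ (≡ᵇ⇒≡ _ _ q)
... | inj₂ q = inj₂ (≡ᵇ⇒≡ _ _ q)

cycAdj-intro : ∀ k (i j : Fin (suc k)) → CycleAdj k (toℕ i) (toℕ j) → T (cycAdj k i j)
cycAdj-intro k i j (inj₁ q) = ∨-introˡ (≡⇒≡ᵇ _ _ q)
cycAdj-intro k i j (inj₂ q) = ∨-introʳ {toℕ j ≡ᵇ (toℕ i + 1) % suc k} (≡⇒≡ᵇ _ _ q)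

-- Let v = 0 with neighbours a and b.  The BFS
-- tree of G - v from a is a path whose depths 0, 1, …, n - 1 number the
-- vertices other than v, ending at b; numbering v as n gives an isomorphism
-- with the cycle C_(suc n).
module DegreeTwoCycle {m : ℕ} (G : Graph (3 + m)) (nonsep : Nonseparable G) (deg≤2 : DegreeAtMost2 G) where
  n : ℕ
  n = 2 + m

  v : Fin (suc n)
  v = zero

  opaque
    a-nbr : Σ (Fin (suc n)) (Edge G v)
    a-nbr = first-step (proj₁ nonsep v (suc zero)) (λ ())

  a : Fin (suc n)
  a = proj₁ a-nbr

  v~a : Edge G v a
  v~a = proj₂ a-nbr

  -- v has a second neighbour, for otherwise a would separate v from the
  -- vertices outside {v, a}
  opaque
    b-nbr : Σ (Fin (suc n)) λ b → Edge G v b × b ≢ a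
    b-nbr with any? (λ b → T? (adj G v b) ×-dec ¬? (b ≟ a))
    ... | yes found = found
    ... | no none =
      ⊥-elim (proj₂ nonsep a (v , w , edge-≢ G v~a ∘ sym , w≢a , proj₁ nonsep v w , no-walk))
      where
      other : Σ (Fin (suc n)) λ w → w ≢ v × w ≢ a
      other with a ≟ suc zero
      ... | yes a≡1 = suc (suc zero) , (λ ()) , λ e → 2≢1 (trans e a≡1)
        where
        2≢1 : _≢_ {A = Fin (suc n)} (suc (suc zero)) (suc zero)
        2≢1 ()
      ... | no a≢1 = suc zero , (λ ()) , a≢1 ∘ sym
      w : Fin (suc n)
      w = proj₁ other
      w≢a : w ≢ a
      w≢a = proj₂ (proj₂ other)
      no-walk : ¬ Walk (EdgeMinus G a) v w
      no-walk wk with first-step wk (proj₁ (proj₂ other) ∘ sym)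
      ... | z , (v~z , _ , z≢a) = none (z , v~z , z≢a)

  b : Fin (suc n)
  b = proj₁ b-nbr

  v~b : Edge G v b
  v~b = proj₁ (proj₂ b-nbr)

  b≢a : b ≢ a
  b≢a = proj₂ (proj₂ b-nbr)

  open TreeAvoiding G nonsep v a (edge-≢ G v~a) hiding (N)

  b≢v : b ≢ v
  b≢v = edge-≢ G v~b

  -- ranks drop by one along parent edges, so no vertex is its own grandparent
  ≢grandparent : ∀ w → w ≢ v → w ≢ a → par w ≢ a → w ≢ par (par w)
  ≢grandparent w w≢v w≢a pw≢a w≡ppw = <-irrefl (cong rank (sym w≡ppw)) (begin-strict
    rank (par (par w)) <⟨ ≤-reflexive (sym (rank-par (par w) (par-≢v w w≢v w≢a) pw≢a)) ⟩
    rank (par w)       <⟨ ≤-reflexive (sym (rank-par w w≢v w≢a)) ⟩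
    rank w             ∎)
    where open ≤-Reasoning

  -- Distinct vertices never share a parent: the parent would get a third
  -- neighbour (its own parent, or v if it is the root a).
  siblings-equal : ∀ x y → x ≢ v → y ≢ v → x ≢ a → y ≢ a → par x ≡ par y → x ≡ y
  siblings-equal x y x≢v y≢v x≢a y≢a px≡py
    with x ≟ y | subst (λ z → Edge G z y) (sym px≡py) (par-edge y y≢v y≢a)
  ... | yes x≡y | _ = x≡y
  ... | no x≢y | px~y with par x ≟ a
  ...   | yes px≡a = ⊥-elim (deg≤2 (par x) x y v (par-edge x x≢v x≢a) px~y
            (subst (λ z → Edge G z v) (sym px≡a) (edge-sym G v a v~a)) x≢y x≢v y≢v)
  ...   | no px≢a = ⊥-elim (deg≤2 (par x) x y (par (par x)) (par-edge x x≢v x≢a) px~y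
            (edge-sym G _ _ (par-edge (par x) (par-≢v x x≢v x≢a) px≢a)) x≢y
            (≢grandparent x x≢v x≢a px≢a)
            (subst (λ z → y ≢ par z) (sym px≡py)
              (≢grandparent y y≢v y≢a (subst (_≢ a) px≡py px≢a))))

  rank-injective : ∀ x y → x ≢ v → y ≢ v → rank x ≡ rank y → x ≡ y
  rank-injective x y x≢v y≢v e = go (rank y) x y x≢v y≢v e refl
    where
    go : ∀ k x y → x ≢ v → y ≢ v → rank x ≡ k → rank y ≡ k → x ≡ y
    go zero x y x≢v y≢v ex ey = trans (rank-0⇒a x x≢v ex) (sym (rank-0⇒a y y≢v ey))
    go (suc k) x y x≢v y≢v ex ey = siblings-equal x y x≢v y≢v x≢a y≢a
      (go k (par x) (par y) (par-≢v x x≢v x≢a) (par-≢v y y≢v y≢a)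
        (suc-injective (trans (sym (rank-par x x≢v x≢a)) ex))
        (suc-injective (trans (sym (rank-par y y≢v y≢a)) ey)))
      where
      x≢a : x ≢ a
      x≢a = rank≢0⇒≢a (λ q → 1+n≢0 (trans (sym ex) q))
      y≢a : y ≢ a
      y≢a = rank≢0⇒≢a (λ q → 1+n≢0 (trans (sym ey) q))

  -- The ancestors of w, one at each depth 0, …, rank w, together with v are
  -- distinct, so rank w + 2 ≤ suc n.
  rank-< : ∀ w → w ≢ v → rank w < n
  rank-< w w≢v = ≤-pred (injective⇒≤ {f = chain} (λ {i} {j} → chain-injective i j))
    where
    r : ℕ
    r = rank w
    chain : Fin (suc (suc r)) → Fin (suc n)
    chain zero = v
    chain (suc i) = up (r ∸ toℕ i) w
    chain-rank : ∀ (i : Fin (suc r)) → rank (chain (suc i)) ≡ toℕ i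
    chain-rank i = trans (up-rank (r ∸ toℕ i) w w≢v) (m∸[m∸n]≡n (≤-pred (toℕ<n i)))
    chain-≢v : ∀ i → chain (suc i) ≢ v
    chain-≢v i = up-≢v (r ∸ toℕ i) w w≢v
    chain-injective : ∀ i j → chain i ≡ chain j → i ≡ j
    chain-injective zero zero e = refl
    chain-injective zero (suc j) e = ⊥-elim (chain-≢v j (sym e))
    chain-injective (suc i) zero e = ⊥-elim (chain-≢v i e)
    chain-injective (suc i) (suc j) e =
      cong suc (toℕ-injective (trans (sym (chain-rank i)) (trans (cong rank e) (chain-rank j))))

  pos : Fin (suc n) → Fin (suc n)
  pos w with w ≟ v
  ... | yes _ = fromℕ n
  ... | no w≢v = fromℕ< (m<n⇒m<1+n (rank-< w w≢v))

  pos-cases : ∀ w → (w ≡ v × toℕ (pos w) ≡ n) ⊎ (w ≢ v × toℕ (pos w) ≡ rank w)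
  pos-cases w with w ≟ v
  ... | yes refl = inj₁ (refl , toℕ-fromℕ n)
  ... | no w≢v = inj₂ (w≢v , toℕ-fromℕ< _)

  pos-injective : ∀ x y → pos x ≡ pos y → x ≡ y
  pos-injective x y e with pos-cases x | pos-cases y
  ... | inj₁ (refl , _) | inj₁ (refl , _) = refl
  ... | inj₁ (_ , px) | inj₂ (y≢v , py) =
    ⊥-elim (<⇒≢ (rank-< y y≢v) (trans (sym py) (trans (cong toℕ (sym e)) px)))
  ... | inj₂ (x≢v , px) | inj₁ (_ , py) =
    ⊥-elim (<⇒≢ (rank-< x x≢v) (trans (sym px) (trans (cong toℕ e) py)))
  ... | inj₂ (x≢v , px) | inj₂ (y≢v , py) =
    rank-injective x y x≢v y≢v (trans (sym px) (trans (cong toℕ e) py))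

  rank-onto : ∀ k → k < n → Σ (Fin (suc n)) λ w → w ≢ v × rank w ≡ k
  rank-onto k k<n with injective⇒onto pos pos-injective (fromℕ< (m<n⇒m<1+n k<n))
  ... | w , e with pos-cases w
  ... | inj₁ (_ , pw) = ⊥-elim (<⇒≢ k<n (trans (sym (toℕ-fromℕ< _)) (trans (cong toℕ (sym e)) pw)))
  ... | inj₂ (w≢v , pw) = w , w≢v , trans (sym pw) (trans (cong toℕ e) (toℕ-fromℕ< _))

  rank-suc⇒child : ∀ x y → x ≢ v → y ≢ v → rank y ≡ suc (rank x) → y ≢ a × par y ≡ x
  rank-suc⇒child x y x≢v y≢v e = y≢a , rank-injective (par y) x (par-≢v y y≢v y≢a) x≢v
      (suc-injective (trans (sym (rank-par y y≢v y≢a)) e))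
    where
    y≢a : y ≢ a
    y≢a = rank≢0⇒≢a (λ q → 1+n≢0 (trans (sym e) q))

  rank-suc⇒edge : ∀ x y → x ≢ v → y ≢ v → rank y ≡ suc (rank x) → Edge G x y
  rank-suc⇒edge x y x≢v y≢v e with rank-suc⇒child x y x≢v y≢v e
  ... | y≢a , refl = par-edge y y≢v y≢a

  -- b is the deepest vertex: a child y of b would be a third neighbour of b.
  rank-b : suc (rank b) ≡ n
  rank-b with m≤n⇒m<n∨m≡n (rank-< b b≢v)
  ... | inj₂ e = e
  ... | inj₁ lt with rank-onto (suc (rank b)) lt
  ... | y , y≢v , ry with rank-suc⇒child b y b≢v y≢v ry
  ... | y≢a , py≡b = ⊥-elim (deg≤2 b v y (par b) (edge-sym G v b v~b)
          (subst (λ z → Edge G z y) py≡b (par-edge y y≢v y≢a))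
          (edge-sym G _ _ (par-edge b b≢v b≢a)) (y≢v ∘ sym) (par-≢v b b≢v b≢a ∘ sym)
          (subst (λ z → y ≢ par z) py≡b (≢grandparent y y≢v y≢a (subst (_≢ a) (sym py≡b) b≢a))))

  rank-is-b : ∀ y → y ≢ v → n ≡ (rank y + 1) % suc n → y ≡ b
  rank-is-b y y≢v q = rank-injective y b y≢v b≢v
    (suc-injective (trans (sym (succ-mod-< (rank-< y y≢v))) (trans (sym q) (sym rank-b))))

  edge⇒consecutive : ∀ x y → x ≢ v → y ≢ v → Edge G x y →
    rank y ≡ suc (rank x) ⊎ rank x ≡ suc (rank y)
  edge⇒consecutive x y x≢v y≢v e with <-cmp (rank x) (rank y)
  ... | tri< lt _ _ = inj₁ (≤-antisym (rank-adj x y (reached x x≢v) (avoid-v-intro x y (e , x≢v , y≢v))) lt)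
  ... | tri≈ _ eq _ = ⊥-elim (edge-≢ G e (sym (rank-injective x y x≢v y≢v eq)))
  ... | tri> _ _ gt =
    inj₂ (≤-antisym (rank-adj y x (reached y y≢v) (avoid-v-intro y x (edge-sym G x y e , y≢v , x≢v))) gt)

  v-nbr : ∀ y → Edge G v y → y ≡ a ⊎ y ≡ b
  v-nbr y e with y ≟ a | y ≟ b
  ... | yes y≡a | _ = inj₁ y≡a
  ... | no _ | yes y≡b = inj₂ y≡b
  ... | no y≢a | no y≢b = ⊥-elim (deg≤2 v a b y v~a v~b e (b≢a ∘ sym) (y≢a ∘ sym) (y≢b ∘ sym))

  b-v-consecutive : n ≡ (rank b + 1) % suc n
  b-v-consecutive = trans (sym rank-b) (sym (succ-mod-< (rank-< b b≢v)))

  v-a-consecutive : rank a ≡ (n + 1) % suc n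
  v-a-consecutive = trans rank-a (sym (succ-mod-top n))

  edge⇒cycle : ∀ x y → Edge G x y → CycleAdj n (toℕ (pos x)) (toℕ (pos y))
  edge⇒cycle x y e with pos-cases x | pos-cases y
  ... | inj₁ (refl , _) | inj₁ (refl , _) = ⊥-elim (edge-≢ G e refl)
  ... | inj₁ (refl , px) | inj₂ (y≢v , py) = subst₂ (CycleAdj n) (sym px) (sym py) from-v
    where
    from-v : CycleAdj n n (rank y)
    from-v with v-nbr y e
    ... | inj₁ refl = inj₁ v-a-consecutive
    ... | inj₂ refl = inj₂ b-v-consecutive
  ... | inj₂ (x≢v , px) | inj₁ (refl , py) = subst₂ (CycleAdj n) (sym px) (sym py) to-v
    where
    to-v : CycleAdj n (rank x) n
    to-v with v-nbr x (edge-sym G x y e)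
    ... | inj₁ refl = inj₂ v-a-consecutive
    ... | inj₂ refl = inj₁ b-v-consecutive
  ... | inj₂ (x≢v , px) | inj₂ (y≢v , py) = subst₂ (CycleAdj n) (sym px) (sym py) between
    where
    between : CycleAdj n (rank x) (rank y)
    between with edge⇒consecutive x y x≢v y≢v e
    ... | inj₁ q = inj₁ (trans q (sym (succ-mod-< (rank-< x x≢v))))
    ... | inj₂ q = inj₂ (trans q (sym (succ-mod-< (rank-< y y≢v))))

  cycle⇒edge : ∀ x y → CycleAdj n (toℕ (pos x)) (toℕ (pos y)) → Edge G x y
  cycle⇒edge x y c with pos-cases x | pos-cases y
  ... | inj₁ (refl , px) | inj₁ (refl , py) = ⊥-elim (no-loop (subst₂ (CycleAdj n) px py c))
    where
    no-loop : ¬ CycleAdj n n n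
    no-loop (inj₁ q) = 1+n≢0 (trans q (succ-mod-top n))
    no-loop (inj₂ q) = 1+n≢0 (trans q (succ-mod-top n))
  ... | inj₁ (refl , px) | inj₂ (y≢v , py) = from-v (subst₂ (CycleAdj n) px py c)
    where
    from-v : CycleAdj n n (rank y) → Edge G v y
    from-v (inj₁ q) = subst (Edge G v) (sym (rank-0⇒a y y≢v (trans q (succ-mod-top n)))) v~a
    from-v (inj₂ q) = subst (Edge G v) (sym (rank-is-b y y≢v q)) v~b
  ... | inj₂ (x≢v , px) | inj₁ (refl , py) = edge-sym G v x (to-v (subst₂ (CycleAdj n) px py c))
    where
    to-v : CycleAdj n (rank x) n → Edge G v x
    to-v (inj₂ q) = subst (Edge G v) (sym (rank-0⇒a x x≢v (trans q (succ-mod-top n)))) v~a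
    to-v (inj₁ q) = subst (Edge G v) (sym (rank-is-b x x≢v q)) v~b
  ... | inj₂ (x≢v , px) | inj₂ (y≢v , py) = between (subst₂ (CycleAdj n) px py c)
    where
    between : CycleAdj n (rank x) (rank y) → Edge G x y
    between (inj₁ q) = rank-suc⇒edge x y x≢v y≢v (trans q (succ-mod-< (rank-< x x≢v)))
    between (inj₂ q) = edge-sym G y x (rank-suc⇒edge y x y≢v x≢v (trans q (succ-mod-< (rank-< y y≢v))))

  iso : Iso G (cycAdj n)
  iso = proj₁ (injective⇒↔ pos pos-injective) , λ x y → T-ext
    (λ e → cycAdj-intro n (pos x) (pos y) (edge⇒cycle x y e))
    (λ t → cycle⇒edge x y (cycAdj-elim n (pos x) (pos y) t))

two-vertices-K₂ : (G : Graph 2) → Connected G → Iso G (adj K₂)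
two-vertices-K₂ G conn = mk↔ₛ′ id id (λ _ → refl) (λ _ → refl) , same-adj
  where
  0~1 : Edge G zero (suc zero)
  0~1 with first-step (conn zero (suc zero)) (λ ())
  ... | zero , e = ⊥-elim (edge-≢ G e refl)
  ... | suc zero , e = e
  same-adj : ∀ x y → adj G x y ≡ adj K₂ x y
  same-adj zero zero = Graph.irrefl G zero
  same-adj zero (suc zero) = T⇒true 0~1
  same-adj (suc zero) zero = T⇒true (edge-sym G zero (suc zero) 0~1)
  same-adj (suc zero) (suc zero) = Graph.irrefl G (suc zero)

even-≥4 : ∀ {m} → Even (3 + m) → 4 ≤ 3 + m
even-≥4 {zero} (even-2+ ())
even-≥4 {suc m} _ = s≤s (s≤s (s≤s (s≤s z≤n)))

lemma2p3 : ∀ {n} (G : Graph (suc n)) → Nonseparable G →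
    (∀ (T : Graph (suc n)) → SpanningTree T G → PerfectMatching T) →
    Iso G (adj K₂) ⊎
      (Σ ℕ λ k → 4 ≤ suc k × (Σ ℕ λ m → suc k ≡ 2 * m) × Iso G (cycAdj k))
lemma2p3 {zero} G nonsep matchable = ⊥-elim (even⇒¬odd even-0 (Setting.even-order G nonsep matchable))
lemma2p3 {suc zero} G nonsep matchable = inj₁ (two-vertices-K₂ G (proj₁ nonsep))
lemma2p3 {suc (suc m)} G nonsep matchable =
  inj₂ (suc (suc m) , even-≥4 even-order , even⇒double even-order , DegreeTwoCycle.iso G nonsep degree-≤2)
  where open Setting G nonsep matchable using (even-order; degree-≤2)
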